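{- Every connected graph $H$ of order $n\ge2$ is an induced subgraph of an $\mathcal{R}_{01,02}$-graph whose Roman domination number equals $2|V(H)|$.
   Context: A Roman dominating function (RDF) on a graph $G$ is a map $f:V(G)\to\{0,1,2\}$ such that every vertex $v$ with $f(v)=0$ has a neighbor $u$ with $f(u)=2$; its weight is $\sum_v f(v)$. The Roman domination number $\gamma_R(G)$ is the minimum weight of an RDF; an RDF of that weight is a $\gamma_R$-function. For $X\subseteq\{0,1,2\}$, $V^X(G)$ is the set of vertices $v$ with $\{f(v): f\text{ a }\gamma_R\text{ -function}\}=X$. $G$ is an $\mathcal{R}_{01,02}$-graph if $V(G)=V^{\{0,1\}}(G)\cup V^{\{0,2\}}(G)$ and both sets are nonempty. -}

module Defs where

open import Data.Nat using (ℕ; zero; suc; _+_; _*_; _≤_)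
open import Data.Fin using (Fin)
open import Data.Bool using (Bool; true; false)
open import Data.List using (List; map; allFin)
open import Data.Nat.ListAction using (sum)
open import Data.Product using (Σ; ∃; _×_; _,_)
open import Relation.Binary.PropositionalEquality using (_≡_; _≢_)
open import Relation.Nullary using (¬_)
open import Function.Definitions using (Injective)

record Graph : Set where
  field
    order : ℕ
    adj   : Fin order → Fin order → Bool
    sym   : ∀ u v → adj u v ≡ adj v u
    irrefl : ∀ v → adj v v ≡ false

open Graph public

data Walk (G : Graph) : Fin (order G) → Fin (order G) → Set where
  here : ∀ v → Walk G v v
  step : ∀ u w v → adj G u w ≡ true → Walk G w v → Walk G u v

Connected : Graph → Set
Connected G = ∀ u v → Walk G u v

InducedSubgraph : Graph → Graph → Set
InducedSubgraph H G =
  Σ (Fin (order H) → Fin (order G)) λ φ →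
    Injective _≡_ _≡_ φ × (∀ u v → adj H u v ≡ adj G (φ u) (φ v))

data Label : Set where
  l0 l1 l2 : Label

val : Label → ℕ
val l0 = 0
val l1 = 1
val l2 = 2

Labelling : Graph → Set
Labelling G = Fin (order G) → Label

weight : (G : Graph) → Labelling G → ℕ
weight G f = sum (map (λ v → val (f v)) (allFin (order G)))

IsRDF : (G : Graph) → Labelling G → Set
IsRDF G f = ∀ v → f v ≡ l0 → ∃ λ u → adj G v u ≡ true × f u ≡ l2

IsγRFunction : (G : Graph) → Labelling G → Set
IsγRFunction G f = IsRDF G f × (∀ g → IsRDF G g → weight G f ≤ weight G g)

RomanNumber : Graph → ℕ → Set
RomanNumber G k = (∃ λ f → IsRDF G f × weight G f ≡ k) × (∀ g → IsRDF G g → k ≤ weight G g)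

-- v ∈ V^X(G): the set {f v : f a γ_R-function} equals X (given by membership predicate).
InV : (G : Graph) → (Label → Set) → Fin (order G) → Set
InV G X v =
  (∀ a → X a → ∃ λ f → IsγRFunction G f × f v ≡ a) ×
  (∀ f → IsγRFunction G f → X (f v))

X01 : Label → Set
X01 a = (a ≡ l0) Data.Sum.⊎ (a ≡ l1)
  where import Data.Sum

X02 : Label → Set
X02 a = (a ≡ l0) Data.Sum.⊎ (a ≡ l2)
  where import Data.Sum

R01,02 : Graph → Set
R01,02 G =
  (∀ v → (InV G X01 v) Data.Sum.⊎ (InV G X02 v)) ×
  (∃ λ v → InV G X01 v) × (∃ λ v → InV G X02 v)
  where import Data.Sum

-- Take the corona of H with two pendant leaves at every vertex.  In a Roman
-- dominating function a leaf labelled 0 forces its hub to be labelled 2, so every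
-- star (hub and its two leaves) carries weight at least 2, with equality exactly
-- for the patterns (2,0,0) and (0,1,1); hence the Roman domination number is 2n and
-- every γ_R-function shows one of these two patterns on each star.  Both patterns
-- occur at any given star: label all hubs 2, or switch one hub i to the pattern
-- (0,1,1), which stays dominating because i has a neighbour in H (H is connected
-- with n ≥ 2).  So the hubs form V^{0,2} and the leaves V^{0,1}.
module Submission where

open import Defs hiding (sym)
open import Data.Bool using (Bool; true; false)
open import Data.Fin using (Fin; zero; suc; _↑ˡ_; _↑ʳ_; combine; remQuot; punchIn; fromℕ<; _≟_)
open import Data.Fin.Patterns using (0F; 1F; 2F)
open import Data.Fin.Properties using (remQuot-combine; combine-remQuot; combine-injectiveˡ; punchInᵢ≢i)
open import Data.List using (map; allFin; tabulate)
open import Data.List.Properties using (map-tabulate)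
open import Data.Nat using (ℕ; zero; suc; _+_; _*_; _≤_; z≤n; s≤s)
open import Data.Nat.Properties
  using (+-0-monoid; +-assoc; *-comm; ≤-antisym; ≤-trans; ≤-reflexive; n≤1+n; +-mono-≤;
         +-monoˡ-≤; +-monoʳ-≤; +-cancelˡ-≤; +-cancelʳ-≤; module ≤-Reasoning)
import Data.Nat.ListAction as List
open import Algebra.Properties.Monoid.Sum +-0-monoid using (sum; sum-cong-≗; sum-syntax)
open import Data.Product using (Σ; ∃; _×_; _,_; uncurry)
open import Data.Sum using (_⊎_; inj₁; inj₂)
open import Function using (_∘_; id)
open import Relation.Binary.PropositionalEquality
open import Relation.Nullary using (yes; does; contradiction)
open import Relation.Nullary.Decidable using (dec-true; dec-false; does-⇔)
open import Function.Bundles using (mk⇔)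

sum-allFin : ∀ n (g : Fin n → ℕ) → List.sum (map g (allFin n)) ≡ ∑[ i < n ] g i
sum-allFin n g = trans (cong List.sum (map-tabulate id g)) (sum-tabulate n g)
  where
  sum-tabulate : ∀ n (g : Fin n → ℕ) → List.sum (tabulate g) ≡ ∑[ i < n ] g i
  sum-tabulate zero    g = refl
  sum-tabulate (suc n) g = cong (g zero +_) (sum-tabulate n (g ∘ suc))

sum-↑ : ∀ m k (g : Fin (m + k) → ℕ) →
        ∑[ i < m + k ] g i ≡ ∑[ i < m ] g (i ↑ˡ k) + ∑[ j < k ] g (m ↑ʳ j)
sum-↑ zero    k g = refl
sum-↑ (suc m) k g =
  trans (cong (g zero +_) (sum-↑ m k (g ∘ suc))) (sym (+-assoc (g zero) _ _))

sum-combine : ∀ m k (g : Fin (m * k) → ℕ) →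
              ∑[ x < m * k ] g x ≡ ∑[ i < m ] ∑[ j < k ] g (combine i j)
sum-combine zero    k g = refl
sum-combine (suc m) k g =
  trans (sum-↑ k (m * k) g)
        (cong (∑[ j < k ] g (j ↑ˡ (m * k)) +_) (sum-combine m k (g ∘ (k ↑ʳ_))))

sum-const : ∀ n c → ∑[ i < n ] c ≡ n * c
sum-const zero    c = refl
sum-const (suc n) c = cong (c +_) (sum-const n c)

sum-lower : ∀ {n c} (t : Fin n → ℕ) → (∀ i → c ≤ t i) → n * c ≤ sum t
sum-lower {zero}  t c≤t = z≤n
sum-lower {suc n} t c≤t = +-mono-≤ (c≤t zero) (sum-lower (t ∘ suc) (c≤t ∘ suc))

sum-lower-tight : ∀ {n c} (t : Fin n → ℕ) → (∀ i → c ≤ t i) → sum t ≤ n * c →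
                  ∀ i → t i ≡ c
sum-lower-tight {suc n} {c} t c≤t ∑t≤ zero = ≤-antisym t₀≤c (c≤t zero)
  where
  t₀≤c : t zero ≤ c
  t₀≤c = +-cancelʳ-≤ (n * c) _ _
           (≤-trans (+-monoʳ-≤ (t zero) (sum-lower (t ∘ suc) (c≤t ∘ suc))) ∑t≤)
sum-lower-tight {suc n} {c} t c≤t ∑t≤ (suc i) =
  sum-lower-tight (t ∘ suc) (c≤t ∘ suc)
    (+-cancelˡ-≤ c _ _ (≤-trans (+-monoˡ-≤ _ (c≤t zero)) ∑t≤)) i

another : ∀ {m} → 2 ≤ m → (i : Fin m) → ∃ λ k → k ≢ i
another {suc (suc _)} _ i = punchIn i zero , punchInᵢ≢i i zero
another {suc zero} (s≤s ()) _

walk-neighbour : ∀ {H : Graph} {i k} → Walk H i k → k ≢ i → ∃ λ j → adj H i j ≡ true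
walk-neighbour (here _)         k≢i = contradiction refl k≢i
walk-neighbour (step _ j _ a _) _   = j , a

adjacent⇒distinct : ∀ (H : Graph) {i j} → adj H i j ≡ true → j ≢ i
adjacent⇒distinct H {i} i~i refl with () ← trans (sym i~i) (irrefl H i)

connected⇒neighbour : (H : Graph) → 2 ≤ order H → Connected H →
                      ∀ i → ∃ λ j → adj H i j ≡ true
connected⇒neighbour H 2≤n conn i with another 2≤n i
... | k , k≢i = walk-neighbour (conn i k) k≢i

-- The two patterns a γ_R-function can show on a star (index 0F is the hub):
-- star false = (2,0,0) and star true = (0,1,1).
star : Bool → Fin 3 → Label
star false 0F      = l2
star false (suc _) = l0
star true  0F      = l0
star true  (suc _) = l1

star-weight : ∀ b → ∑[ r < 3 ] val (star b r) ≡ 2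
star-weight false = refl
star-weight true  = refl

star-hub : ∀ b → X02 (star b 0F)
star-hub false = inj₂ refl
star-hub true  = inj₁ refl

star-leaf : ∀ b r → X01 (star b (suc r))
star-leaf false r = inj₁ refl
star-leaf true  r = inj₂ refl

StarGuarded : (Fin 3 → Label) → Set
StarGuarded g = ∀ r → g (suc r) ≡ l0 → g 0F ≡ l2

starGuarded-classify : ∀ g → StarGuarded g →
                       (∃ λ b → g ≗ star b) ⊎ 3 ≤ ∑[ r < 3 ] val (g r)
starGuarded-classify g guard with shape (g 0F) (g 1F) (g 2F) (guard 0F) (guard 1F)
  where
  shape : ∀ x y z → (y ≡ l0 → x ≡ l2) → (z ≡ l0 → x ≡ l2) →
          (∃ λ b → star b 0F ≡ x × star b 1F ≡ y × star b 2F ≡ z) ⊎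
          3 ≤ val x + (val y + (val z + 0))
  shape l2 l0 l0 _  _  = inj₁ (false , refl , refl , refl)
  shape l2 l0 l1 _  _  = inj₂ (s≤s (s≤s (s≤s z≤n)))
  shape l2 l0 l2 _  _  = inj₂ (s≤s (s≤s (s≤s z≤n)))
  shape l2 l1 _  _  _  = inj₂ (s≤s (s≤s (s≤s z≤n)))
  shape l2 l2 _  _  _  = inj₂ (s≤s (s≤s (s≤s z≤n)))
  shape l0 l1 l1 _  _  = inj₁ (true , refl , refl , refl)
  shape l0 l1 l2 _  _  = inj₂ (s≤s (s≤s (s≤s z≤n)))
  shape l0 l2 l1 _  _  = inj₂ (s≤s (s≤s (s≤s z≤n)))
  shape l0 l2 l2 _  _  = inj₂ (s≤s (s≤s (s≤s z≤n)))
  shape l1 l1 l1 _  _  = inj₂ (s≤s (s≤s (s≤s z≤n)))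
  shape l1 l1 l2 _  _  = inj₂ (s≤s (s≤s (s≤s z≤n)))
  shape l1 l2 _  _  _  = inj₂ (s≤s (s≤s (s≤s z≤n)))
  shape l0 l0 _  gy _  with () ← gy refl
  shape l1 l0 _  gy _  with () ← gy refl
  shape l0 _  l0 _  gz with () ← gz refl
  shape l1 _  l0 _  gz with () ← gz refl
... | inj₁ (b , e₀ , e₁ , e₂) = inj₁ (b , λ { 0F → sym e₀ ; 1F → sym e₁ ; 2F → sym e₂ })
... | inj₂ 3≤ = inj₂ 3≤

starGuarded-weight≥2 : ∀ g → StarGuarded g → 2 ≤ ∑[ r < 3 ] val (g r)
starGuarded-weight≥2 g guard with starGuarded-classify g guard
... | inj₁ (b , g≗star) =
  ≤-reflexive (sym (trans (sum-cong-≗ (cong val ∘ g≗star)) (star-weight b)))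
... | inj₂ 3≤ = ≤-trans (n≤1+n 2) 3≤

-- The corona of H with two pendant leaves at each vertex; vertex i r is the hub i
-- for r = 0F and one of its two leaves otherwise.
module TwoLeafCorona (H : Graph) where

  n : ℕ
  n = order H

  adjacent : Fin n × Fin 3 → Fin n × Fin 3 → Bool
  adjacent (i , 0F)    (j , 0F)    = adj H i j
  adjacent (i , 0F)    (j , suc _) = does (i ≟ j)
  adjacent (i , suc _) (j , 0F)    = does (i ≟ j)
  adjacent (i , suc _) (j , suc _) = false

  adjacent-sym : ∀ p q → adjacent p q ≡ adjacent q p
  adjacent-sym (i , 0F)    (j , 0F)    = Graph.sym H i j
  adjacent-sym (i , 0F)    (j , suc _) = does-⇔ (mk⇔ sym sym) (i ≟ j) (j ≟ i)
  adjacent-sym (i , suc _) (j , 0F)    = does-⇔ (mk⇔ sym sym) (i ≟ j) (j ≟ i)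
  adjacent-sym (i , suc _) (j , suc _) = refl

  adjacent-irrefl : ∀ p → adjacent p p ≡ false
  adjacent-irrefl (i , 0F)    = irrefl H i
  adjacent-irrefl (i , suc _) = refl

  leaf-adjacent : ∀ i r p → adjacent (i , suc r) p ≡ true → p ≡ (i , 0F)
  leaf-adjacent i r (j , 0F) e with i ≟ j
  leaf-adjacent i r (i , 0F) e | yes refl = refl

  corona : Graph
  corona = record
    { order  = n * 3
    ; adj    = λ x y → adjacent (remQuot 3 x) (remQuot 3 y)
    ; sym    = λ x y → adjacent-sym (remQuot 3 x) (remQuot 3 y)
    ; irrefl = λ x → adjacent-irrefl (remQuot 3 x)
    }

  vertex : Fin n → Fin 3 → Fin (n * 3)
  vertex = combine

  vertex-elim : (P : Fin (n * 3) → Set) → (∀ i r → P (vertex i r)) → ∀ x → P x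
  vertex-elim P p x = subst P (combine-remQuot {n} 3 x) (uncurry p (remQuot 3 x))

  adj-vertex : ∀ i r j s → adj corona (vertex i r) (vertex j s) ≡ adjacent (i , r) (j , s)
  adj-vertex i r j s = cong₂ adjacent (remQuot-combine i r) (remQuot-combine j s)

  hub-induced : InducedSubgraph H corona
  hub-induced = (λ i → vertex i 0F)
              , (λ {i} {j} e → combine-injectiveˡ i 0F j 0F e)
              , (λ i j → sym (adj-vertex i 0F j 0F))

  leaf-guard : ∀ f → IsRDF corona f → ∀ i → StarGuarded (f ∘ vertex i)
  leaf-guard f rdf i r leaf≡0 with rdf (vertex i (suc r)) leaf≡0
  ... | u , leaf~u , fu≡2 = subst (λ v → f v ≡ l2) u≡hub fu≡2
    where
    u≡hub : u ≡ vertex i 0F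
    u≡hub = trans (sym (combine-remQuot {n} 3 u))
              (cong (uncurry combine)
                (leaf-adjacent i r (remQuot 3 u)
                  (subst (λ p → adjacent p (remQuot 3 u) ≡ true) (remQuot-combine i (suc r)) leaf~u)))

  starWeight : Labelling corona → Fin n → ℕ
  starWeight f i = ∑[ r < 3 ] val (f (vertex i r))

  weight-stars : ∀ f → weight corona f ≡ ∑[ i < n ] starWeight f i
  weight-stars f = trans (sum-allFin (n * 3) (val ∘ f)) (sum-combine n 3 (val ∘ f))

  rdf-starWeight≥2 : ∀ f → IsRDF corona f → ∀ i → 2 ≤ starWeight f i
  rdf-starWeight≥2 f rdf i = starGuarded-weight≥2 (f ∘ vertex i) (leaf-guard f rdf i)

  rdf-weight≥ : ∀ f → IsRDF corona f → 2 * n ≤ weight corona f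
  rdf-weight≥ f rdf = begin
    2 * n                         ≡⟨ *-comm 2 n ⟩
    n * 2                         ≤⟨ sum-lower (starWeight f) (rdf-starWeight≥2 f rdf) ⟩
    ∑[ i < n ] starWeight f i     ≡⟨ weight-stars f ⟨
    weight corona f               ∎
    where open ≤-Reasoning

  canonical : (Fin n → Bool) → Labelling corona
  canonical S = uncurry (star ∘ S) ∘ remQuot 3

  canonical-vertex : ∀ S i r → canonical S (vertex i r) ≡ star (S i) r
  canonical-vertex S i r = cong (uncurry (star ∘ S)) (remQuot-combine i r)

  canonical-weight : ∀ S → weight corona (canonical S) ≡ 2 * n
  canonical-weight S = begin
    weight corona (canonical S)       ≡⟨ weight-stars (canonical S) ⟩
    ∑[ i < n ] starWeight (canonical S) i
      ≡⟨ sum-cong-≗ (λ i → trans (sum-cong-≗ (cong val ∘ canonical-vertex S i)) (star-weight (S i))) ⟩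
    ∑[ i < n ] 2                      ≡⟨ sum-const n 2 ⟩
    n * 2                             ≡⟨ *-comm n 2 ⟩
    2 * n                             ∎
    where open ≡-Reasoning

  ExternallyDominated : (Fin n → Bool) → Set
  ExternallyDominated S = ∀ i → S i ≡ true → ∃ λ j → adj H i j ≡ true × S j ≡ false

  canonical-isRDF : ∀ S → ExternallyDominated S → IsRDF corona (canonical S)
  canonical-isRDF S dom = vertex-elim _ λ i r →
    subst (λ a → a ≡ l0 → ∃ λ u → adj corona (vertex i r) u ≡ true × canonical S u ≡ l2)
          (sym (canonical-vertex S i r)) (star-dominated i r)
    where
    dominator : ∀ i r j s → adjacent (i , r) (j , s) ≡ true → star (S j) s ≡ l2 →
                ∃ λ u → adj corona (vertex i r) u ≡ true × canonical S u ≡ l2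
    dominator i r j s a l = vertex j s , trans (adj-vertex i r j s) a
                                       , trans (canonical-vertex S j s) l
    star-dominated : ∀ i r → star (S i) r ≡ l0 →
                     ∃ λ u → adj corona (vertex i r) u ≡ true × canonical S u ≡ l2
    star-dominated i 0F _ with S i in Si
    ... | true with dom i Si
    ...   | j , i~j , Sj = dominator i 0F j 0F i~j (cong (λ b → star b 0F) Sj)
    star-dominated i (suc r) _ with S i in Si
    ... | false = dominator i (suc r) i 0F (dec-true (i ≟ i) refl) (cong (λ b → star b 0F) Si)

  none : Fin n → Bool
  none _ = false

  none-externallyDominated : ExternallyDominated none
  none-externallyDominated i ()

  canonical-γ : ∀ S → ExternallyDominated S → IsγRFunction corona (canonical S)
  canonical-γ S dom =
    canonical-isRDF S dom
    , λ g rdf → subst (_≤ weight corona g) (sym (canonical-weight S)) (rdf-weight≥ g rdf)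

  γR : RomanNumber corona (2 * n)
  γR = (canonical none , canonical-isRDF none none-externallyDominated , canonical-weight none)
     , rdf-weight≥

  γ-starShaped : ∀ f → IsγRFunction corona f → ∀ i → ∃ λ b → f ∘ vertex i ≗ star b
  γ-starShaped f (rdf , minimal) i
    with starGuarded-classify (f ∘ vertex i) (leaf-guard f rdf i)
  ... | inj₁ shaped = shaped
  ... | inj₂ 3≤ = contradiction (subst (3 ≤_) (starWeight≡2 i) 3≤) (λ { (s≤s (s≤s ())) })
    where
    weight≤ : sum (starWeight f) ≤ n * 2
    weight≤ = subst₂ _≤_ (weight-stars f) (trans (canonical-weight none) (*-comm 2 n))
                (minimal (canonical none) (canonical-isRDF none none-externallyDominated))
    starWeight≡2 : ∀ i → starWeight f i ≡ 2
    starWeight≡2 = sum-lower-tight (starWeight f) (rdf-starWeight≥2 f rdf) weight≤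

  module _ (neighbour : ∀ i → ∃ λ j → adj H i j ≡ true) where

    only : Fin n → Fin n → Bool
    only i k = does (k ≟ i)

    only-externallyDominated : ∀ i → ExternallyDominated (only i)
    only-externallyDominated i k _ with k ≟ i
    ... | yes refl = let j , k~j = neighbour k in
                     j , k~j , dec-false (j ≟ k) (adjacent⇒distinct H k~j)

    star-realised : ∀ b i r → ∃ λ f → IsγRFunction corona f × f (vertex i r) ≡ star b r
    star-realised false i r = canonical none , canonical-γ none none-externallyDominated
                            , canonical-vertex none i r
    star-realised true  i r =
      canonical (only i) , canonical-γ (only i) (only-externallyDominated i)
      , trans (canonical-vertex (only i) i r) (cong (λ b → star b r) (dec-true (i ≟ i) refl))

    hub-V02 : ∀ i → InV corona X02 (vertex i 0F)
    hub-V02 i =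
      (λ { _ (inj₁ refl) → star-realised true i 0F ; _ (inj₂ refl) → star-realised false i 0F })
      , λ f γ → let b , shaped = γ-starShaped f γ i in subst X02 (sym (shaped 0F)) (star-hub b)

    leaf-V01 : ∀ i r → InV corona X01 (vertex i (suc r))
    leaf-V01 i r =
      (λ { _ (inj₁ refl) → star-realised false i (suc r) ; _ (inj₂ refl) → star-realised true i (suc r) })
      , λ f γ → let b , shaped = γ-starShaped f γ i in subst X01 (sym (shaped (suc r))) (star-leaf b r)

    R01,02-corona : Fin n → R01,02 corona
    R01,02-corona i₀ = vertex-elim _ (λ { i 0F → inj₂ (hub-V02 i) ; i (suc r) → inj₁ (leaf-V01 i r) })
                     , (vertex i₀ 1F , leaf-V01 i₀ 0F)
                     , (vertex i₀ 0F , hub-V02 i₀)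

proposition6p3 : (H : Graph) → 2 ≤ order H → Connected H →
    Σ Graph λ G → R01,02 G × InducedSubgraph H G × RomanNumber G (2 * order H)
proposition6p3 H 2≤n conn =
  corona , R01,02-corona (connected⇒neighbour H 2≤n conn) (fromℕ< 2≤n) , hub-induced , γR
  where open TwoLeafCorona H
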